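{- For every integer $n\ge 1$, the $n$-dimensional hypercube $Q_n$ is of class one.
   Context: The cartesian product $G\times H$ has vertex set $V(G)\times V(H)$, with $(u,v)$ adjacent to $(x,y)$ iff either $u=x$ and $vy\in E(H)$, or $v=y$ and $ux\in E(G)$. $Q_0=K_1$ and $Q_n=Q_{n-1}\times K_2$ for $n\ge1$. $\beta(G)$ is the size of a minimum vertex cover. Alcuin problem: the vertices of $G$ are items initially on the left bank of a river; a man with a boat of capacity $b$ (a positive integer) must carry them all to the right bank so that no two adjacent vertices are ever left together on a bank. Formally, a feasible schedule for capacity $b$ is a sequence of triples $(L_k,B_k,R_k)$, $k=1,\dots,s$, $s$ odd, such that: each triple is a partition of $V$; $L_k$ and $R_k$ are independent sets; $|B_k|\le b$; $L_1\cup B_1=V$; $B_s\cup R_s=V$; for even $k$, $L_k=L_{k-1}$ and $B_k\cup R_k=B_{k-1}\cup R_{k-1}$; for odd $k\ge 3$, $R_k=R_{k-1}$ and $B_k\cup L_k=B_{k-1}\cup L_{k-1}$. The Alcuin number $c(G)$ is the least positive integer $b$ for which a feasible schedule exists. One always has $\beta(G)\le c(G)\le \beta(G)+1$; $G$ is of class one if $c(G)=\beta(G)$ and of class two if $c(G)=\beta(G)+1$. -}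

module Defs where

open import Data.Nat using (ℕ; zero; suc; _*_; _≤_; _+_)
open import Data.Nat.Properties using ()
open import Data.Fin using (Fin; zero; suc; toℕ; inject₁; fromℕ; remQuot)
open import Data.Fin.Subset using (Subset; inside; outside; _∈_; ∣_∣)
open import Data.Vec using (tabulate)
open import Data.Product using (Σ; _×_; _,_; proj₁; proj₂)
open import Data.Sum using (_⊎_)
open import Data.Empty using (⊥)
open import Relation.Nullary using (¬_)
open import Relation.Binary.PropositionalEquality using (_≡_; _≢_)
open import Function.Bundles using (_⇔_)

record Graph : Set₁ where
  field
    V     : ℕ
    Adj   : Fin V → Fin V → Set
    adj-sym : ∀ {u v} → Adj u v → Adj v u
    adj-irrefl : ∀ {u} → ¬ Adj u u
open Graph public

K1 : Graph
K1 = record { V = 1 ; Adj = λ _ _ → ⊥ ; adj-sym = λ () ; adj-irrefl = λ () }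

K2 : Graph
K2 = record { V = 2 ; Adj = λ u v → u ≢ v
            ; adj-sym = λ p q → p (Relation.Binary.PropositionalEquality.sym q)
            ; adj-irrefl = λ p → p Relation.Binary.PropositionalEquality.refl }

-- Cartesian product G □ H.  Vertex set V(G) × V(H), encoded as
-- Fin (V G * V H) via the bijection remQuot.
_□_ : Graph → Graph → Graph
G □ H = record { V = V G * V H ; Adj = A ; adj-sym = s ; adj-irrefl = i }
  where
  open Relation.Binary.PropositionalEquality using (sym)
  pr = remQuot {V G} (V H)
  A : Fin (V G * V H) → Fin (V G * V H) → Set
  A p q = (proj₁ (pr p) ≡ proj₁ (pr q) × Adj H (proj₂ (pr p)) (proj₂ (pr q)))
        ⊎ (proj₂ (pr p) ≡ proj₂ (pr q) × Adj G (proj₁ (pr p)) (proj₁ (pr q)))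
  s : ∀ {p q} → A p q → A q p
  s (Data.Sum.inj₁ (e , a)) = Data.Sum.inj₁ (sym e , Graph.adj-sym H a)
  s (Data.Sum.inj₂ (e , a)) = Data.Sum.inj₂ (sym e , Graph.adj-sym G a)
  i : ∀ {p} → ¬ A p p
  i (Data.Sum.inj₁ (_ , a)) = Graph.adj-irrefl H a
  i (Data.Sum.inj₂ (_ , a)) = Graph.adj-irrefl G a

Q : ℕ → Graph
Q zero    = K1
Q (suc n) = Q n □ K2

IsVertexCover : (G : Graph) → Subset (V G) → Set
IsVertexCover G S = ∀ u v → Adj G u v → u ∈ S ⊎ v ∈ S

IsVertexCoverNumber : Graph → ℕ → Set
IsVertexCoverNumber G k =
  Σ (Subset (V G)) (λ S → IsVertexCover G S × ∣ S ∣ ≡ k)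
  × (∀ (S : Subset (V G)) → IsVertexCover G S → k ≤ ∣ S ∣)

-- Alcuin schedules.
-- A triple (L,B,R) partitioning V is encoded as a map V → Bank.

data Bank : Set where
  left boat right : Bank

Config : Graph → Set
Config G = Fin (V G) → Bank

part : ∀ {G} → Config G → Bank → Subset (V G)
part c x = tabulate (λ v → side (c v) x)
  where
  side : Bank → Bank → Data.Fin.Subset.Side
  side left  left  = inside
  side boat  boat  = inside
  side right right = inside
  side _     _     = outside

IndependentPart : (G : Graph) → Config G → Bank → Set
IndependentPart G c x = ∀ u v → c u ≡ x → c v ≡ x → ¬ Adj G u v

data Even : ℕ → Set
data Odd  : ℕ → Set
data Even where
  ezero : Even zero
  esuc  : ∀ {n} → Odd n → Even (suc n)
data Odd where
  osuc : ∀ {n} → Even n → Odd (suc n)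

EvenStep : (G : Graph) → Config G → Config G → Set
EvenStep G c d = ∀ v → ((d v ≡ left) ⇔ (c v ≡ left))
                     × ((d v ≡ boat ⊎ d v ≡ right) ⇔ (c v ≡ boat ⊎ c v ≡ right))

OddStep : (G : Graph) → Config G → Config G → Set
OddStep G c d = ∀ v → ((d v ≡ right) ⇔ (c v ≡ right))
                    × ((d v ≡ boat ⊎ d v ≡ left) ⇔ (c v ≡ boat ⊎ c v ≡ left))

-- A feasible schedule of odd length s = suc m for capacity b:
-- triples indexed by Fin (suc m); triple i has 1-based index toℕ i + 1.
record FeasibleSchedule (G : Graph) (b : ℕ) : Set where
  field
    m      : ℕ
    sOdd   : Odd (suc m)
    conf   : Fin (suc m) → Config G
    indepL : ∀ k → IndependentPart G (conf k) left
    indepR : ∀ k → IndependentPart G (conf k) right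
    cap    : ∀ k → ∣ part {G} (conf k) boat ∣ ≤ b
    start  : ∀ v → conf zero v ≡ left ⊎ conf zero v ≡ boat
    finish : ∀ v → conf (fromℕ m) v ≡ boat ⊎ conf (fromℕ m) v ≡ right
    -- transition into triple number k = toℕ i + 2 (≥ 2)
    step   : ∀ (i : Fin m) →
               (Even (toℕ i + 2) → EvenStep G (conf (inject₁ i)) (conf (suc i)))
             × (Odd  (toℕ i + 2) → OddStep  G (conf (inject₁ i)) (conf (suc i)))

IsAlcuinNumber : Graph → ℕ → Set
IsAlcuinNumber G b =
  1 ≤ b × FeasibleSchedule G b
  × (∀ b' → 1 ≤ b' → FeasibleSchedule G b' → b ≤ b')

ClassOne : Graph → Set
ClassOne G = Σ ℕ (λ k → IsVertexCoverNumber G k × IsAlcuinNumber G k)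

-- A graph with a proper 2-colouring is carried over the river in three
-- trips: one colour class rides in the boat while the other waits on the
-- left bank, the boat is unloaded on the right bank, and the second class is
-- taken aboard.  So c(G) is at most the size of the larger colour class.
-- Conversely, on the first trip everything not in the boat stays on an
-- independent bank, so the first boatload is a vertex cover and c(G) ≥ β(G).
-- In the prism G □ K₂ the rungs (g,0)–(g,1) form a perfect matching: every
-- vertex cover meets each rung and every proper 2-colouring splits each rung,
-- so both colour classes have |V(G)| vertices and β = |V(G)|.  Since
-- Q (n+1) = Q n □ K₂ is bipartite, it is of class one.
module Submission where

open import Defs
open import Data.Nat using (ℕ; _≤_; zero; suc; _+_; _*_; z≤n; s≤s)
open import Data.Nat.Properties using (≤-trans; ≤-reflexive; m≤m*n)
open import Data.Bool using (Bool; true; false; not; _xor_)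
open import Data.Bool.Properties using (not-injective; xor-comm)
open import Data.Fin using (Fin; suc; toℕ; inject₁; combine; remQuot)
open import Data.Fin.Patterns using (0F; 1F; 2F)
open import Data.Fin.Properties using (remQuot-combine)
open import Data.Fin.Subset using (Subset; ∣_∣; _∈_)
open import Data.Fin.Subset.Properties using (drop-there; ∣p∣≤∣x∷p∣; p⊆q⇒∣p∣≤∣q∣)
open import Data.Vec using (_∷_; here; there; lookup; tabulate)
open import Data.Vec.Properties using (lookup∘tabulate; tabulate-cong; []=⇒lookup; lookup⇒[]=)
open import Data.Product using (_×_; _,_; proj₁; proj₂)
open import Data.Sum using (_⊎_; inj₁; inj₂)
import Data.Sum as Sum
open import Data.Empty using (⊥-elim)
open import Function using (_∘_; id)
open import Function.Bundles using (mk⇔)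
open import Relation.Binary.PropositionalEquality using (_≡_; _≢_; refl; sym; trans; cong; subst; subst₂)

∈-tabulate⁺ : ∀ {n} {f : Fin n → Bool} {x} → f x ≡ true → x ∈ tabulate f
∈-tabulate⁺ {f = f} {x} fx = lookup⇒[]= x (tabulate f) (trans (lookup∘tabulate f x) fx)

∈-tabulate⁻ : ∀ {n} {f : Fin n → Bool} {x} → x ∈ tabulate f → f x ≡ true
∈-tabulate⁻ {f = f} {x} x∈ = trans (sym (lookup∘tabulate f x)) ([]=⇒lookup x∈)

∣tabulate∣-mono : ∀ {n} {f g : Fin n → Bool} →
  (∀ x → f x ≡ true → g x ≡ true) → ∣ tabulate f ∣ ≤ ∣ tabulate g ∣
∣tabulate∣-mono f⇒g = p⊆q⇒∣p∣≤∣q∣ (λ {x} x∈ → ∈-tabulate⁺ (f⇒g x (∈-tabulate⁻ x∈)))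

xor-injectiveʳ : ∀ x {y z} → x xor y ≡ x xor z → y ≡ z
xor-injectiveʳ true  = not-injective
xor-injectiveʳ false = id

xor-injectiveˡ : ∀ {x y} z → x xor z ≡ y xor z → x ≡ y
xor-injectiveˡ {x} {y} z e = xor-injectiveʳ z (trans (xor-comm z x) (trans e (xor-comm y z)))

_,0 _,1 : ∀ {a} → Fin a → Fin (a * 2)
i ,0 = combine i 0F
i ,1 = combine i 1F

pairwise-covering⇒≤∣p∣ : ∀ a (p : Subset (a * 2)) →
  (∀ (i : Fin a) → i ,0 ∈ p ⊎ i ,1 ∈ p) → a ≤ ∣ p ∣
pairwise-covering⇒≤∣p∣ zero    p           covers = z≤n
pairwise-covering⇒≤∣p∣ (suc a) (x ∷ y ∷ p) covers
  with covers 0F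
     | pairwise-covering⇒≤∣p∣ a p (Sum.map (drop-there ∘ drop-there) (drop-there ∘ drop-there) ∘ covers ∘ suc)
... | inj₁ here         | a≤∣p∣ = s≤s (≤-trans a≤∣p∣ (∣p∣≤∣x∷p∣ y p))
... | inj₂ (there here) | a≤∣p∣ = ≤-trans (s≤s a≤∣p∣) (∣p∣≤∣x∷p∣ x (y ∷ p))

pairwise-distinct⇒∣tabulate∣≡ : ∀ a (f : Fin (a * 2) → Bool) →
  (∀ (i : Fin a) → f (i ,0) ≢ f (i ,1)) → ∣ tabulate f ∣ ≡ a
pairwise-distinct⇒∣tabulate∣≡ zero    f distinct = refl
pairwise-distinct⇒∣tabulate∣≡ (suc a) f distinct
  with f 0F | f 1F | distinct 0F
     | pairwise-distinct⇒∣tabulate∣≡ a (λ k → f (suc (suc k))) (distinct ∘ suc)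
... | true  | true  | t≢t | _      = ⊥-elim (t≢t refl)
... | true  | false | _   | ∣rest∣ = cong suc ∣rest∣
... | false | true  | _   | ∣rest∣ = cong suc ∣rest∣
... | false | false | f≢f | _      = ⊥-elim (f≢f refl)

IsProperTwoColouring : (G : Graph) → (Fin (V G) → Bool) → Set
IsProperTwoColouring G χ = ∀ {u v} → Adj G u v → χ u ≢ χ v

not-isProperTwoColouring : ∀ {G χ} → IsProperTwoColouring G χ → IsProperTwoColouring G (not ∘ χ)
not-isProperTwoColouring proper adj = proper adj ∘ not-injective

colourClass-isVertexCover : ∀ {G χ} → IsProperTwoColouring G χ → IsVertexCover G (tabulate χ)
colourClass-isVertexCover {χ = χ} proper u v adj with χ u in χu≡ | χ v in χv≡
... | true  | _     = inj₁ (∈-tabulate⁺ χu≡)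
... | false | true  = inj₂ (∈-tabulate⁺ χv≡)
... | false | false = ⊥-elim (proper adj (trans χu≡ (sym χv≡)))

isBoat : Bank → Bool
isBoat boat = true
isBoat _    = false

-- The membership test inside `part` is local to Defs; evaluating `part` on
-- the one-vertex graph K1 exposes it.
part-boat : ∀ {G} (c : Config G) → part {G} c boat ≡ tabulate (isBoat ∘ c)
part-boat c = tabulate-cong (λ v → inBoat (c v))
  where
  inBoat : ∀ x → lookup (part {K1} (λ _ → x) boat) 0F ≡ isBoat x
  inBoat left  = refl
  inBoat boat  = refl
  inBoat right = refl

∈-boat⁺ : ∀ {G} {c : Config G} {v} → c v ≡ boat → v ∈ part {G} c boat
∈-boat⁺ {G} {c} cv≡boat = subst (_ ∈_) (sym (part-boat {G} c)) (∈-tabulate⁺ (cong isBoat cv≡boat))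

∣boat∣≤ : ∀ {G} (c : Config G) (g : Fin (V G) → Bool) →
  (∀ v → c v ≡ boat → g v ≡ true) → ∣ part {G} c boat ∣ ≤ ∣ tabulate g ∣
∣boat∣≤ {G} c g boat⇒g = subst (λ p → ∣ p ∣ ≤ ∣ tabulate g ∣) (sym (part-boat {G} c))
  (∣tabulate∣-mono (λ v → boat⇒g v ∘ isBoat⇒≡boat (c v)))
  where
  isBoat⇒≡boat : ∀ x → isBoat x ≡ true → x ≡ boat
  isBoat⇒≡boat boat _ = refl
  isBoat⇒≡boat left  ()
  isBoat⇒≡boat right ()

firstBoat-isVertexCover : ∀ {G b} (σ : FeasibleSchedule G b) →
  IsVertexCover G (part {G} (FeasibleSchedule.conf σ 0F) boat)
firstBoat-isVertexCover {G} σ u v adj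
  with FeasibleSchedule.start σ u | FeasibleSchedule.start σ v
... | inj₂ u∈boat | _           = inj₁ (∈-boat⁺ {G} u∈boat)
... | inj₁ _      | inj₂ v∈boat = inj₂ (∈-boat⁺ {G} v∈boat)
... | inj₁ u∈left | inj₁ v∈left = ⊥-elim (FeasibleSchedule.indepL σ 0F u v u∈left v∈left adj)

capacity≥vertexCoverBound : ∀ {G k b} → (∀ S → IsVertexCover G S → k ≤ ∣ S ∣) →
  FeasibleSchedule G b → k ≤ b
capacity≥vertexCoverBound bound σ =
  ≤-trans (bound _ (firstBoat-isVertexCover σ)) (FeasibleSchedule.cap σ 0F)

crossing : Fin 3 → Bool → Bank
crossing 0F true  = boat
crossing 0F false = left
crossing 1F true  = right
crossing 1F false = left
crossing 2F true  = right
crossing 2F false = boat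

crossing-injective : ∀ i {x y} → crossing i x ≡ crossing i y → x ≡ y
crossing-injective _  {true}  {true}  _ = refl
crossing-injective _  {false} {false} _ = refl
crossing-injective 0F {true}  {false} ()
crossing-injective 0F {false} {true}  ()
crossing-injective 1F {true}  {false} ()
crossing-injective 1F {false} {true}  ()
crossing-injective 2F {true}  {false} ()
crossing-injective 2F {false} {true}  ()

bipartiteSchedule : ∀ {G b} (χ : Fin (V G) → Bool) → IsProperTwoColouring G χ →
  ∣ tabulate χ ∣ ≤ b → ∣ tabulate (not ∘ χ) ∣ ≤ b → FeasibleSchedule G b
bipartiteSchedule {G} {b} χ proper ∣χ∣≤b ∣notχ∣≤b = record
  { m      = 2
  ; sOdd   = osuc (esuc (osuc ezero))
  ; conf   = trip
  ; indepL = λ i → banks-independent i left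
  ; indepR = λ i → banks-independent i right
  ; cap    = cap
  ; start  = start
  ; finish = finish
  ; step   = step
  }
  where
  trip : Fin 3 → Config G
  trip i v = crossing i (χ v)

  banks-independent : ∀ i x → IndependentPart G (trip i) x
  banks-independent i x u v u∈x v∈x adj = proper adj (crossing-injective i (trans u∈x (sym v∈x)))

  cap : ∀ i → ∣ part {G} (trip i) boat ∣ ≤ b
  cap 0F = ≤-trans (∣boat∣≤ {G} (trip 0F) χ (λ v → first (χ v))) ∣χ∣≤b
    where
    first : ∀ x → crossing 0F x ≡ boat → x ≡ true
    first true  _ = refl
    first false ()
  cap 1F = ≤-trans (∣boat∣≤ {G} (trip 1F) χ (λ v → empty (χ v))) ∣χ∣≤b
    where
    empty : ∀ x → crossing 1F x ≡ boat → x ≡ true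
    empty true  ()
    empty false ()
  cap 2F = ≤-trans (∣boat∣≤ {G} (trip 2F) (not ∘ χ) (λ v → second (χ v))) ∣notχ∣≤b
    where
    second : ∀ x → crossing 2F x ≡ boat → not x ≡ true
    second true  ()
    second false _ = refl

  start : ∀ v → trip 0F v ≡ left ⊎ trip 0F v ≡ boat
  start v with χ v
  ... | true  = inj₂ refl
  ... | false = inj₁ refl

  finish : ∀ v → trip 2F v ≡ boat ⊎ trip 2F v ≡ right
  finish v with χ v
  ... | true  = inj₂ refl
  ... | false = inj₁ refl

  landing : EvenStep G (trip 0F) (trip 1F)
  landing v with χ v
  ... | true  = mk⇔ (λ ()) (λ ()) , mk⇔ (λ _ → inj₁ refl) (λ _ → inj₂ refl)
  ... | false = mk⇔ id id , mk⇔ (λ { (inj₁ ()) ; (inj₂ ()) }) (λ { (inj₁ ()) ; (inj₂ ()) })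

  reloading : OddStep G (trip 1F) (trip 2F)
  reloading v with χ v
  ... | true  = mk⇔ id id , mk⇔ (λ { (inj₁ ()) ; (inj₂ ()) }) (λ { (inj₁ ()) ; (inj₂ ()) })
  ... | false = mk⇔ (λ ()) (λ ()) , mk⇔ (λ _ → inj₂ refl) (λ _ → inj₁ refl)

  step : ∀ (i : Fin 2) →
    (Even (toℕ i + 2) → EvenStep G (trip (inject₁ i)) (trip (suc i)))
    × (Odd (toℕ i + 2) → OddStep G (trip (inject₁ i)) (trip (suc i)))
  step 0F = (λ _ → landing) , λ { (osuc (esuc ())) }
  step 1F = (λ { (esuc (osuc (esuc ()))) }) , λ _ → reloading

balancedBipartite⇒classOne : ∀ {G k} (χ : Fin (V G) → Bool) → IsProperTwoColouring G χ →
  ∣ tabulate χ ∣ ≡ k → ∣ tabulate (not ∘ χ) ∣ ≡ k →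
  (∀ S → IsVertexCover G S → k ≤ ∣ S ∣) → 1 ≤ k → ClassOne G
balancedBipartite⇒classOne {G} {k} χ proper ∣χ∣≡k ∣notχ∣≡k bound 1≤k =
  k , ((tabulate χ , colourClass-isVertexCover {G} proper , ∣χ∣≡k) , bound)
    , (1≤k , bipartiteSchedule χ proper (≤-reflexive ∣χ∣≡k) (≤-reflexive ∣notχ∣≡k)
           , λ _ _ → capacity≥vertexCoverBound bound)

□-adjacentʳ : ∀ G H {p q} {g : Fin (V G)} {j j' : Fin (V H)} →
  remQuot {V G} (V H) p ≡ (g , j) → remQuot {V G} (V H) q ≡ (g , j') →
  Adj H j j' → Adj (G □ H) p q
□-adjacentʳ G H p≡ q≡ adj =
  inj₁ ( trans (cong proj₁ p≡) (sym (cong proj₁ q≡))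
       , subst₂ (Adj H) (sym (cong proj₂ p≡)) (sym (cong proj₂ q≡)) adj)

rung-adjacent : ∀ G (g : Fin (V G)) → Adj (G □ K2) (g ,0) (g ,1)
rung-adjacent G g = □-adjacentʳ G K2 (remQuot-combine g 0F) (remQuot-combine g 1F) (λ ())

prism-vertexCover-size : ∀ G (S : Subset (V (G □ K2))) → IsVertexCover (G □ K2) S → V G ≤ ∣ S ∣
prism-vertexCover-size G S cover = pairwise-covering⇒≤∣p∣ (V G) S (λ g → cover _ _ (rung-adjacent G g))

prism-colourClass-size : ∀ G (χ : Fin (V (G □ K2)) → Bool) → IsProperTwoColouring (G □ K2) χ →
  ∣ tabulate χ ∣ ≡ V G
prism-colourClass-size G χ proper = pairwise-distinct⇒∣tabulate∣≡ (V G) χ (λ g → proper (rung-adjacent G g))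

bit : Fin 2 → Bool
bit 0F = false
bit 1F = true

bit-injective : ∀ {j j'} → bit j ≡ bit j' → j ≡ j'
bit-injective {0F} {0F} _ = refl
bit-injective {1F} {1F} _ = refl
bit-injective {0F} {1F} ()
bit-injective {1F} {0F} ()

prismColouring : ∀ G → (Fin (V G) → Bool) → Fin (V (G □ K2)) → Bool
prismColouring G χ p = χ (proj₁ (remQuot {V G} 2 p)) xor bit (proj₂ (remQuot {V G} 2 p))

prismColouring-proper : ∀ G {χ : Fin (V G) → Bool} → IsProperTwoColouring G χ →
  IsProperTwoColouring (G □ K2) (prismColouring G χ)
prismColouring-proper G {χ} proper {u} {v} = coordinates (remQuot {V G} 2 u) (remQuot {V G} 2 v)
  where
  colour : Fin (V G) × Fin 2 → Bool
  colour (g , j) = χ g xor bit j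
  coordinates : ∀ x y →
    (proj₁ x ≡ proj₁ y × proj₂ x ≢ proj₂ y) ⊎ (proj₂ x ≡ proj₂ y × Adj G (proj₁ x) (proj₁ y)) →
    colour x ≢ colour y
  coordinates (g , j) (.g , j') (inj₁ (refl , j≢j')) = j≢j' ∘ bit-injective ∘ xor-injectiveʳ (χ g)
  coordinates (g , j) (g' , .j) (inj₂ (refl , g~g')) = proper g~g' ∘ xor-injectiveˡ (bit j)

prism-classOne : ∀ G (χ : Fin (V G) → Bool) → IsProperTwoColouring G χ → 1 ≤ V G → ClassOne (G □ K2)
prism-classOne G χ proper 1≤∣V∣ =
  balancedBipartite⇒classOne ψ ψ-proper
    (prism-colourClass-size G ψ ψ-proper)
    (prism-colourClass-size G (not ∘ ψ) (not-isProperTwoColouring {G □ K2} ψ-proper))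
    (prism-vertexCover-size G) 1≤∣V∣
  where
  ψ : Fin (V (G □ K2)) → Bool
  ψ = prismColouring G χ
  ψ-proper : IsProperTwoColouring (G □ K2) ψ
  ψ-proper = prismColouring-proper G proper

hypercubeColouring : ∀ n → Fin (V (Q n)) → Bool
hypercubeColouring zero    _ = false
hypercubeColouring (suc n)   = prismColouring (Q n) (hypercubeColouring n)

hypercubeColouring-proper : ∀ n → IsProperTwoColouring (Q n) (hypercubeColouring n)
hypercubeColouring-proper zero    ()
hypercubeColouring-proper (suc n) = prismColouring-proper (Q n) (hypercubeColouring-proper n)

1≤∣V[Q]∣ : ∀ n → 1 ≤ V (Q n)
1≤∣V[Q]∣ zero    = s≤s z≤n
1≤∣V[Q]∣ (suc n) = ≤-trans (1≤∣V[Q]∣ n) (m≤m*n (V (Q n)) 2)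

corollary3p7 : ∀ (n : ℕ) → 1 ≤ n → ClassOne (Q n)
corollary3p7 (suc n) _ =
  prism-classOne (Q n) (hypercubeColouring n) (hypercubeColouring-proper n) (1≤∣V[Q]∣ n)
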